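{- Let $n$ be a positive integer and $p$ a positive divisor of $n$. A permutation $\pi\in S_n$ has a difference sequence that is periodic with period dividing $p$ if and only if there exists a triple \[(\varphi,\mathcal R,k)\in S_p\times\prod_{i=1}^{p}\left(\{0\}\cup\left[\tfrac{n}{p}-1\right]\right)\times\mathbb Z_{n/p}\] with $\gcd(k,\tfrac np)=1$ such that for all $i\in\mathbb Z_n$, \[\pi(i)=\mathcal R_{i \bmod p}\cdot p+\varphi(i\bmod p)+kp\left\lfloor\tfrac{i-1}{p}\right\rfloor .\] Moreover, $\pi$ is uniquely determined by such a triple.
   Context: Permutations in $S_n$ are bijections of $\mathbb Z_n$, written $[\pi(1)\ \cdots\ \pi(n)]$, with elements of $\mathbb Z_n$ represented by $1,\dots,n$ (so values of the displayed formula are read modulo $n$, and $i\bmod p$ denotes the representative in $\{1,\dots,p\}$). $[m]=\{1,\dots,m\}$. The difference sequence of $\pi\in S_n$ is $D_\pi\in\mathbb Z_n^n$ with $D_\pi(k)=\pi(k+1)-\pi(k)$ for $1\le k<n$ and $D_\pi(n)=\pi(1)-\pi(n)$; it is periodic with period dividing $p$ if $D_\pi(k+p)=D_\pi(k)$ for all $k$ (indices mod $n$). -}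

module Defs where

open import Data.Nat using (ℕ; suc; _+_; _*_; _∸_; _<_; NonZero)
open import Data.Nat.DivMod using (_%_; _/_; m%n<n)
open import Data.Fin using (Fin; toℕ; fromℕ<)
open import Data.Fin.Permutation using (Permutation′; _⟨$⟩ʳ_)
open import Relation.Binary.PropositionalEquality using (_≡_)

-- Convention: an element i ∈ {1,…,n} (representing ℤ_n) is encoded by the
-- 0-based index j = i - 1 ∈ Fin n.  So π ∈ S_n is a Permutation′ n and the
-- displayed value π(i) is  suc (toℕ (π ⟨$⟩ʳ j)).

idx : (n : ℕ) .{{_ : NonZero n}} → ℕ → Fin n
idx n j = fromℕ< (m%n<n j n)

val : ∀ {n} .{{_ : NonZero n}} → Permutation′ n → ℕ → ℕ
val {n} π j = suc (toℕ (π ⟨$⟩ʳ idx n j))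

diff : ∀ {n} .{{_ : NonZero n}} → Permutation′ n → ℕ → ℕ
diff {n} π j = (val π (suc j) + n ∸ val π j) % n

DiffPeriodic : ∀ {n} .{{_ : NonZero n}} → Permutation′ n → ℕ → Set
DiffPeriodic {n} π p = ∀ (j : Fin n) → diff π (toℕ j + p) ≡ diff π (toℕ j)

-- π(i) = R_{i mod p}·p + φ(i mod p) + k p ⌊(i-1)/p⌋  in ℤ_n, for all i,
-- with i = j+1, so i mod p ↔ idx p j and ⌊(i-1)/p⌋ = j / p.
Formula : ∀ {n} .{{_ : NonZero n}} (p : ℕ) .{{_ : NonZero p}} →
          Permutation′ p → (Fin p → ℕ) → Fin (n / p) → Permutation′ n → Set
Formula {n} p φ R k π =
  ∀ (j : Fin n) →
    val π (toℕ j) % n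
      ≡ (R (idx p (toℕ j)) * p + suc (toℕ (φ ⟨$⟩ʳ idx p (toℕ j)))
          + toℕ k * p * (toℕ j / p)) % n

-- D_π is p-periodic exactly when π(j + p) − π(j) ≡ c (mod n) for a constant c.  Iterating,
-- π(x + t p) ≡ π(x) + t c, so by injectivity of π, t c ≡ 0 iff n ∣ t p.  Taking t = n/p
-- gives c = k p, and if d divides k and n/p = e d, then e c ≡ 0, so n ∣ e p and d = 1.
-- Moreover π(x) ≡ π(x mod p) (mod p), so i ↦ π(i) mod p maps the first block onto ℤ_p and is
-- a permutation φ; with π(i) = R_i p + φ(i) on the first block, the iteration is the
-- displayed formula.  Conversely the formula gives π(j + p) ≡ π(j) + k p, and it fixes π mod n.
module Submission where

open import Data.Fin using (Fin; toℕ; fromℕ<; punchOut)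
open import Data.Fin.Permutation using (Permutation′; _⟨$⟩ʳ_; _⟨$⟩ˡ_; inverseʳ; permutation)
open import Data.Fin.Properties as Fin
  using (any?; injective⇒≤; punchOut-injective; toℕ-injective; toℕ<n; toℕ-fromℕ<)
open import Data.Nat
open import Data.Nat.Coprimality using (Coprime; coprime⇒gcd≡1)
open import Data.Nat.DivMod
open import Data.Nat.Divisibility
open _∣_ using (quotient; equality)
open import Data.Nat.GCD using (gcd)
open import Data.Nat.Properties
open import Data.Nat.Tactic.RingSolver using (solve-∀)
open import Data.Product using (Σ; _×_; _,_; proj₁; proj₂)
open import Function.Base using (_∘_)
open import Function.Bundles using (Injection; Equivalence; _⇔_; mk⇔)
open import Function.Definitions using (Injective; Surjective; StrictlyInverseˡ; StrictlyInverseʳ)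
open import Function.Properties.Inverse using (↔⇒↣)
open import Level using (0ℓ)
open import Relation.Binary.Bundles using (Setoid)
import Relation.Binary.Construct.On as On
import Relation.Binary.Reasoning.Setoid as SetoidReasoning
open import Relation.Binary.PropositionalEquality
  using (_≡_; _≢_; refl; sym; trans; cong; cong₂; subst; subst₂; isEquivalence; module ≡-Reasoning)
open import Relation.Nullary using (yes; no; contradiction)

open import Defs

injective⇒surjective : ∀ {n} {f : Fin n → Fin n} → Injective _≡_ _≡_ f → Surjective _≡_ _≡_ f
injective⇒surjective {zero} _ ()
injective⇒surjective {suc n} {f} f-injective y with any? (λ x → f x Fin.≟ y)
... | yes (x , fx≡y) = x , λ { refl → fx≡y }
... | no ∄x = contradiction (injective⇒≤ punchOut∘f-injective) 1+n≰n
  where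
  y≢f : ∀ x → y ≢ f x
  y≢f x y≡fx = ∄x (x , sym y≡fx)

  punchOut∘f-injective : Injective _≡_ _≡_ (λ x → punchOut (y≢f x))
  punchOut∘f-injective eq = f-injective (punchOut-injective (y≢f _) (y≢f _) eq)

strictlyInverseˡ⇒strictlyInverseʳ : ∀ {n} {f g : Fin n → Fin n} →
  StrictlyInverseˡ _≡_ f g → StrictlyInverseʳ _≡_ f g
strictlyInverseˡ⇒strictlyInverseʳ {f = f} {g} f∘g≡id x = begin
  g (f x)     ≡⟨ cong (g ∘ f) (sym gy≡x) ⟩
  g (f (g y)) ≡⟨ cong g (f∘g≡id y) ⟩
  g y         ≡⟨ gy≡x ⟩
  x           ∎
  where
  open ≡-Reasoning

  g-injective : Injective _≡_ _≡_ g
  g-injective {y} {y′} gy≡gy′ = trans (sym (f∘g≡id y)) (trans (cong f gy≡gy′) (f∘g≡id y′))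

  y : Fin _
  y = proj₁ (injective⇒surjective g-injective x)

  gy≡x : g y ≡ x
  gy≡x = proj₂ (injective⇒surjective g-injective x) refl

module Modulo (n : ℕ) .{{_ : NonZero n}} where

  infix 4 _≈_
  _≈_ : ℕ → ℕ → Set
  a ≈ b = a % n ≡ b % n

  ≈-setoid : Setoid 0ℓ 0ℓ
  ≈-setoid = record { _≈_ = _≈_ ; isEquivalence = On.isEquivalence (_% n) isEquivalence }

  open Setoid ≈-setoid public using () renaming (sym to ≈-sym)
  module ≈-Reasoning = SetoidReasoning ≈-setoid

  0%n≡0 : 0 % n ≡ 0
  0%n≡0 = m<n⇒m%n≡m (>-nonZero⁻¹ n)

  %-≈ : ∀ a → a % n ≈ a
  %-≈ a = m%n%n≡m%n a n

  +-multiple-≈ : ∀ a k → a + k * n ≈ a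
  +-multiple-≈ a k = [m+kn]%n≡m%n a k n

  +-cong : ∀ {a b c d} → a ≈ b → c ≈ d → a + c ≈ b + d
  +-cong {a} {b} {c} {d} a≈b c≈d = begin
    (a + c) % n             ≡⟨ %-distribˡ-+ a c n ⟩
    (a % n + c % n) % n     ≡⟨ cong₂ (λ x y → (x + y) % n) a≈b c≈d ⟩
    (b % n + d % n) % n     ≡⟨ %-distribˡ-+ b d n ⟨
    (b + d) % n             ∎
    where open ≡-Reasoning

  +-cancelʳ : ∀ {a b} c → a + c ≈ b + c → a ≈ b
  +-cancelʳ {a} {b} c a+c≈b+c = begin
    a                       ≈⟨ undo a ⟨
    a + c + (n ∸ c % n)     ≈⟨ +-cong a+c≈b+c refl ⟩
    b + c + (n ∸ c % n)     ≈⟨ undo b ⟩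
    b                       ∎
    where
    open ≈-Reasoning

    undo : ∀ x → x + c + (n ∸ c % n) ≈ x
    undo x = begin
      x + c + (n ∸ c % n)       ≈⟨ +-cong (+-cong {x} refl (≈-sym (%-≈ c))) refl ⟩
      x + c % n + (n ∸ c % n)   ≡⟨ +-assoc x (c % n) _ ⟩
      x + (c % n + (n ∸ c % n)) ≡⟨ cong (x +_) (m+[n∸m]≡n (m%n≤n c n)) ⟩
      x + n                     ≈⟨ [m+n]%n≡m%n x n ⟩
      x                         ∎

  +-cancelˡ : ∀ {a b} c → c + a ≈ c + b → a ≈ b
  +-cancelˡ {a} {b} c c+a≈c+b =
    +-cancelʳ c (trans (cong (_% n) (+-comm a c)) (trans c+a≈c+b (cong (_% n) (+-comm c b))))

  [m+n∸o]%n+o≈m : ∀ m {o} → o ≤ n → (m + n ∸ o) % n + o ≈ m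
  [m+n∸o]%n+o≈m m {o} o≤n = begin
    (m + n ∸ o) % n + o     ≈⟨ +-cong (%-≈ (m + n ∸ o)) refl ⟩
    m + n ∸ o + o           ≡⟨ m∸n+n≡m (≤-trans o≤n (m≤n+m n m)) ⟩
    m + n                   ≈⟨ [m+n]%n≡m%n m n ⟩
    m                       ∎
    where open ≈-Reasoning

  ≈⇒≡ : ∀ {a b} → a < n → b < n → a ≈ b → a ≡ b
  ≈⇒≡ a<n b<n a≈b = trans (sym (m<n⇒m%n≡m a<n)) (trans a≈b (m<n⇒m%n≡m b<n))

  ≈0⇒∣ : ∀ {a} → a ≈ 0 → n ∣ a
  ≈0⇒∣ {a} a≈0 = m%n≡0⇒n∣m a n (trans a≈0 0%n≡0)

  ∣⇒≈0 : ∀ {a} → n ∣ a → a ≈ 0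
  ∣⇒≈0 {a} n∣a = trans (n∣m⇒m%n≡0 a n n∣a) (sym 0%n≡0)

toℕ-idx : ∀ n .{{_ : NonZero n}} j → toℕ (idx n j) ≡ j % n
toℕ-idx n j = toℕ-fromℕ< (m%n<n j n)

idx-cong : ∀ {n} .{{_ : NonZero n}} {i j} → i % n ≡ j % n → idx n i ≡ idx n j
idx-cong {n} {i} {j} i≈j = toℕ-injective (trans (toℕ-idx n i) (trans i≈j (sym (toℕ-idx n j))))

idx-toℕ : ∀ {n} .{{_ : NonZero n}} (i : Fin n) → idx n (toℕ i) ≡ i
idx-toℕ {n} i = toℕ-injective (trans (toℕ-idx n (toℕ i)) (m<n⇒m%n≡m (toℕ<n i)))

pos : ∀ {n} .{{_ : NonZero n}} → Permutation′ n → ℕ → ℕ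
pos {n} π j = toℕ (π ⟨$⟩ʳ idx n j)

module _ {n : ℕ} .{{_ : NonZero n}} where
  open Modulo n

  val-cong : ∀ (π : Permutation′ n) {i j} → i ≈ j → val π i ≡ val π j
  val-cong π i≈j = cong (λ x → suc (toℕ (π ⟨$⟩ʳ x))) (idx-cong i≈j)

  val-≈⇒≡ : ∀ (π σ : Permutation′ n) {i j} → val π i ≈ val σ j → π ⟨$⟩ʳ idx n i ≡ σ ⟨$⟩ʳ idx n j
  val-≈⇒≡ π σ πi≈σj = toℕ-injective (≈⇒≡ (toℕ<n _) (toℕ<n _) (+-cancelˡ 1 πi≈σj))

  val-injective : ∀ (π : Permutation′ n) {i j} → val π i ≈ val π j → i ≈ j
  val-injective π {i} {j} πi≈πj =
    trans (sym (toℕ-idx n i))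
      (trans (cong toℕ (Injection.injective (↔⇒↣ π) (val-≈⇒≡ π π πi≈πj))) (toℕ-idx n j))

  diff-cong : ∀ (π : Permutation′ n) {i j} → i ≈ j → diff π i ≡ diff π j
  diff-cong π {i} {j} i≈j =
    cong₂ (λ x y → (x + n ∸ y) % n) (val-cong π (+-cong {1} refl i≈j)) (val-cong π i≈j)

  diff+val≈val : ∀ (π : Permutation′ n) j → diff π j + val π j ≈ val π (suc j)
  diff+val≈val π j = [m+n∸o]%n+o≈m (val π (suc j)) (toℕ<n (π ⟨$⟩ʳ idx n j))

  record ShiftsBy (π : Permutation′ n) (p c : ℕ) : Set where
    constructor shiftsBy
    field step : ∀ j → val π (j + p) ≈ val π j + c

  open ShiftsBy

  shiftsBy⇒diffPeriodic : ∀ {π p c} → ShiftsBy π p c → DiffPeriodic π p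
  shiftsBy⇒diffPeriodic {π} {p} {c} (shiftsBy shift) j =
    ≈⇒≡ (m%n<n _ n) (m%n<n _ n) (+-cancelʳ (val π (toℕ j + p)) (begin
      D (J + p) + val π (J + p)   ≈⟨ diff+val≈val π (J + p) ⟩
      val π (suc J + p)           ≈⟨ shift (suc J) ⟩
      val π (suc J) + c           ≈⟨ +-cong (diff+val≈val π J) refl ⟨
      D J + val π J + c           ≡⟨ +-assoc (D J) (val π J) c ⟩
      D J + (val π J + c)         ≈⟨ +-cong {D J} refl (shift J) ⟨
      D J + val π (J + p)         ∎))
    where
    open ≈-Reasoning

    J : ℕ
    J = toℕ j

    D : ℕ → ℕ
    D = diff π

  diffPeriodic⇒shiftsBy : ∀ {π p} → DiffPeriodic π p → ShiftsBy π p ((val π p + n ∸ val π 0) % n)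
  diffPeriodic⇒shiftsBy {π} {p} periodic = shiftsBy shift
    where
    D : ℕ → ℕ
    D = diff π

    c : ℕ
    c = (val π p + n ∸ val π 0) % n

    periodic′ : ∀ j → D (j + p) ≡ D j
    periodic′ j = begin
      D (j + p)                   ≡⟨ diff-cong π (+-cong (≈-sym (%-≈ j)) refl) ⟩
      D (j % n + p)               ≡⟨ cong (λ i → D (i + p)) (toℕ-idx n j) ⟨
      D (toℕ (idx n j) + p)       ≡⟨ periodic (idx n j) ⟩
      D (toℕ (idx n j))           ≡⟨ cong D (toℕ-idx n j) ⟩
      D (j % n)                   ≡⟨ diff-cong π (%-≈ j) ⟩
      D j                         ∎
      where open ≡-Reasoning

    shift : ∀ j → val π (j + p) ≈ val π j + c
    shift zero = begin
      val π p                     ≈⟨ [m+n∸o]%n+o≈m (val π p) (toℕ<n (π ⟨$⟩ʳ idx n 0)) ⟨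
      c + val π 0                 ≡⟨ +-comm c (val π 0) ⟩
      val π 0 + c                 ∎
      where open ≈-Reasoning
    shift (suc j) = begin
      val π (suc j + p)           ≈⟨ diff+val≈val π (j + p) ⟨
      D (j + p) + val π (j + p)   ≡⟨ cong (_+ val π (j + p)) (periodic′ j) ⟩
      D j + val π (j + p)         ≈⟨ +-cong {D j} refl (shift j) ⟩
      D j + (val π j + c)         ≡⟨ +-assoc (D j) (val π j) c ⟨
      D j + val π j + c           ≈⟨ +-cong (diff+val≈val π j) refl ⟩
      val π (suc j) + c           ∎
      where open ≈-Reasoning

  shiftsBy-iterate : ∀ {π p c} → ShiftsBy π p c → ∀ x t → val π (x + t * p) ≈ val π x + t * c
  shiftsBy-iterate {π} {p} {c} shift x zero =
    trans (cong (λ y → val π y % n) (+-identityʳ x)) (cong (_% n) (sym (+-identityʳ (val π x))))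
  shiftsBy-iterate {π} {p} {c} shift x (suc t) = begin
    val π (x + (p + t * p))     ≡⟨ cong (val π) (swap x p (t * p)) ⟩
    val π (x + t * p + p)       ≈⟨ step shift (x + t * p) ⟩
    val π (x + t * p) + c       ≈⟨ +-cong (shiftsBy-iterate shift x t) refl ⟩
    val π x + t * c + c         ≡⟨ swap (val π x) c (t * c) ⟨
    val π x + (c + t * c)       ∎
    where
    open ≈-Reasoning

    swap : ∀ a b c → a + (b + c) ≡ a + c + b
    swap a b c = trans (cong (a +_) (+-comm b c)) (sym (+-assoc a c b))

  shiftsBy-annihilator : ∀ {π p c} → ShiftsBy π p c → ∀ t → t * c ≈ 0 ⇔ t * p ≈ 0
  shiftsBy-annihilator {π} {p} {c} shift t = mk⇔ to from
    where
    open ≈-Reasoning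

    to : t * c ≈ 0 → t * p ≈ 0
    to tc≈0 = val-injective π (begin
      val π (t * p)               ≈⟨ shiftsBy-iterate shift 0 t ⟩
      val π 0 + t * c             ≈⟨ +-cong {val π 0} refl tc≈0 ⟩
      val π 0 + 0                 ≡⟨ +-identityʳ (val π 0) ⟩
      val π 0                     ∎)

    from : t * p ≈ 0 → t * c ≈ 0
    from tp≈0 = +-cancelˡ (val π 0) (begin
      val π 0 + t * c             ≈⟨ shiftsBy-iterate shift 0 t ⟨
      val π (t * p)               ≡⟨ val-cong π tp≈0 ⟩
      val π 0                     ≡⟨ +-identityʳ (val π 0) ⟨
      val π 0 + 0                 ∎)

module Blocks (n p : ℕ) .{{_ : NonZero n}} .{{_ : NonZero p}} (p∣n : p ∣ n) where
  open Modulo n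

  m : ℕ
  m = n / p

  n≡m*p : n ≡ m * p
  n≡m*p = sym (m/n*n≡m p∣n)

  instance
    m-nonZero : NonZero m
    m-nonZero = >-nonZero (m≥n⇒m/n>0 (∣⇒≤ p∣n))

  ≈⇒≡-mod-p : ∀ {a b} → a ≈ b → a % p ≡ b % p
  ≈⇒≡-mod-p {a} {b} a≈b =
    trans (sym (m∣n⇒o%n%m≡o%m p n a p∣n)) (trans (cong (_% p) a≈b) (m∣n⇒o%n%m≡o%m p n b p∣n))

  shiftsBy⇒∣ : ∀ {π : Permutation′ n} {c} → ShiftsBy π p c → p ∣ c
  shiftsBy⇒∣ {π} {c} shift = *-cancelˡ-∣ m (subst (_∣ m * c) n≡m*p (≈0⇒∣ m*c≈0))
    where
    m*c≈0 : m * c ≈ 0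
    m*c≈0 = Equivalence.from (shiftsBy-annihilator shift m) (∣⇒≈0 (subst (n ∣_) n≡m*p ∣-refl))

  diffPeriodic⇒blockShift : ∀ {π : Permutation′ n} → DiffPeriodic π p →
    Σ (Fin m) λ k → ShiftsBy π p (toℕ k * p)
  diffPeriodic⇒blockShift {π} periodic = fromℕ< k<m , subst (ShiftsBy π p) c≡kp shift
    where
    c : ℕ
    c = (val π p + n ∸ val π 0) % n

    shift : ShiftsBy π p c
    shift = diffPeriodic⇒shiftsBy periodic

    p∣c : p ∣ c
    p∣c = shiftsBy⇒∣ shift

    k<m : quotient p∣c < m
    k<m = *-cancelʳ-< p _ m (subst₂ _<_ (equality p∣c) n≡m*p (m%n<n _ n))

    c≡kp : c ≡ toℕ (fromℕ< k<m) * p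
    c≡kp = trans (equality p∣c) (cong (_* p) (sym (toℕ-fromℕ< k<m)))

  shiftsBy⇒coprime : ∀ {π : Permutation′ n} {k} → ShiftsBy π p (k * p) → Coprime k m
  shiftsBy⇒coprime {π} {k} shift {d} (d∣k , d∣m) = ∣1⇒≡1 (*-cancelˡ-∣ (e * p) ep*d∣ep*1)
    where
    e : ℕ
    e = quotient d∣m

    m≡e*d : m ≡ e * d
    m≡e*d = equality d∣m

    instance
      e*p-nonZero : NonZero (e * p)
      e*p-nonZero = m*n≢0 e p {{m*n≢0⇒m≢0 e {d} {{subst NonZero m≡e*d m-nonZero}}}}

    e*kp≡q*n : e * (k * p) ≡ quotient d∣k * n
    e*kp≡q*n = begin
      e * (k * p)                     ≡⟨ cong (λ x → e * (x * p)) (equality d∣k) ⟩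
      e * (quotient d∣k * d * p)      ≡⟨ rearrange e (quotient d∣k) d p ⟩
      quotient d∣k * (e * d * p)      ≡⟨ cong (λ x → quotient d∣k * (x * p)) m≡e*d ⟨
      quotient d∣k * (m * p)          ≡⟨ cong (quotient d∣k *_) n≡m*p ⟨
      quotient d∣k * n                ∎
      where
      open ≡-Reasoning

      rearrange : ∀ a b c d → a * (b * c * d) ≡ b * (a * c * d)
      rearrange = solve-∀

    n∣e*p : n ∣ e * p
    n∣e*p = ≈0⇒∣ (Equivalence.to (shiftsBy-annihilator shift e)
                     (∣⇒≈0 {e * (k * p)} (divides (quotient d∣k) e*kp≡q*n)))

    n≡e*p*d : n ≡ e * p * d
    n≡e*p*d = trans n≡m*p (trans (cong (_* p) m≡e*d) (swap e d p))
      where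
      swap : ∀ a b c → a * b * c ≡ a * c * b
      swap = solve-∀

    ep*d∣ep*1 : e * p * d ∣ e * p * 1
    ep*d∣ep*1 = subst₂ _∣_ n≡e*p*d (sym (*-identityʳ (e * p))) n∣e*p

  module Residues {π : Permutation′ n} {k : ℕ} (shift : ShiftsBy π p (k * p)) where

    pos%p≡pos[%p]%p : ∀ x → pos π x % p ≡ pos π (x % p) % p
    pos%p≡pos[%p]%p x = Modulo.+-cancelˡ p 1 (begin
      val π x % p
        ≡⟨ cong (λ y → val π y % p) (m≡m%n+[m/n]*n x p) ⟩
      val π (x % p + x / p * p) % p
        ≡⟨ ≈⇒≡-mod-p (shiftsBy-iterate shift (x % p) (x / p)) ⟩
      (val π (x % p) + x / p * (k * p)) % p
        ≡⟨ %-remove-+ʳ (val π (x % p)) (∣n⇒∣m*n (x / p) (n∣m*n k)) ⟩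
      val π (x % p) % p
        ∎)
      where open ≡-Reasoning

    residue : Fin p → Fin p
    residue i = idx p (pos π (toℕ i))

    residue⁻¹ : Fin p → Fin p
    residue⁻¹ y = idx p (toℕ (π ⟨$⟩ˡ idx n (toℕ y)))

    residue∘residue⁻¹ : StrictlyInverseˡ _≡_ residue residue⁻¹
    residue∘residue⁻¹ y = toℕ-injective (begin
      toℕ (residue (residue⁻¹ y))                 ≡⟨ toℕ-idx p _ ⟩
      pos π (toℕ (residue⁻¹ y)) % p               ≡⟨ cong (λ z → pos π z % p) (toℕ-idx p x) ⟩
      pos π (x % p) % p                           ≡⟨ pos%p≡pos[%p]%p x ⟨
      pos π x % p                                 ≡⟨ cong (λ z → toℕ (π ⟨$⟩ʳ z) % p) (idx-toℕ _) ⟩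
      toℕ (π ⟨$⟩ʳ (π ⟨$⟩ˡ idx n (toℕ y))) % p     ≡⟨ cong (λ z → toℕ z % p) (inverseʳ π) ⟩
      toℕ (idx n (toℕ y)) % p                     ≡⟨ cong (_% p) (toℕ-idx n (toℕ y)) ⟩
      toℕ y % n % p                               ≡⟨ m∣n⇒o%n%m≡o%m p n (toℕ y) p∣n ⟩
      toℕ y % p                                   ≡⟨ m<n⇒m%n≡m (toℕ<n y) ⟩
      toℕ y                                       ∎)
      where
      open ≡-Reasoning

      x : ℕ
      x = toℕ (π ⟨$⟩ˡ idx n (toℕ y))

    φ : Permutation′ p
    φ = permutation residue residue⁻¹ residue∘residue⁻¹
          (strictlyInverseˡ⇒strictlyInverseʳ {f = residue} {residue⁻¹} residue∘residue⁻¹)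

  block : Permutation′ n → Fin p → ℕ
  block π i = pos π (toℕ i) / p

  block<m : ∀ π i → block π i < m
  block<m π i = m<n*o⇒m/o<n (subst (pos π (toℕ i) <_) n≡m*p (toℕ<n _))

  shiftsBy⇒formula : ∀ {π : Permutation′ n} {k : Fin m} (shift : ShiftsBy π p (toℕ k * p)) →
    Formula p (Residues.φ {k = toℕ k} shift) (block π) k π
  shiftsBy⇒formula {π} {k} shift j = begin
    val π J
      ≡⟨ cong (val π) (m≡m%n+[m/n]*n J p) ⟩
    val π (J % p + J / p * p)
      ≈⟨ shiftsBy-iterate shift (J % p) (J / p) ⟩
    suc (pos π (J % p)) + J / p * K
      ≡⟨ cong (λ r → suc (pos π r) + J / p * K) (toℕ-idx p J) ⟨
    suc a + J / p * K
      ≡⟨ cong (λ z → suc z + J / p * K) (m≡m%n+[m/n]*n a p) ⟩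
    suc (a % p + a / p * p) + J / p * K
      ≡⟨ regroup (a % p) (a / p) (J / p) (toℕ k) p ⟩
    a / p * p + suc (a % p) + toℕ k * p * (J / p)
      ≡⟨ cong (λ r → a / p * p + suc r + toℕ k * p * (J / p)) (toℕ-idx p a) ⟨
    a / p * p + suc (toℕ (idx p a)) + toℕ k * p * (J / p)
      ∎
    where
    open ≈-Reasoning

    J K a : ℕ
    J = toℕ j
    K = toℕ k * p
    a = pos π (toℕ (idx p J))

    regroup : ∀ r q t k p → suc (r + q * p) + t * (k * p) ≡ q * p + suc r + k * p * t
    regroup = solve-∀

  Representation : Permutation′ n → Set
  Representation π = Σ (Permutation′ p) λ φ → Σ (Fin p → ℕ) λ R → Σ (Fin m) λ k →
    ((i : Fin p) → R i < m) × (gcd (toℕ k) m ≡ 1) × Formula p φ R k π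

  diffPeriodic⇒representation : ∀ π → DiffPeriodic π p → Representation π
  diffPeriodic⇒representation π periodic =
    let (k , shift) = diffPeriodic⇒blockShift {π} periodic
    in  Residues.φ {k = toℕ k} shift , block π , k , block<m π ,
        coprime⇒gcd≡1 (shiftsBy⇒coprime {k = toℕ k} shift) , shiftsBy⇒formula {k = k} shift

  module _ (φ : Permutation′ p) (R : Fin p → ℕ) (k : Fin m) where

    formulaRHS : ℕ → ℕ
    formulaRHS j = R (idx p j) * p + suc (toℕ (φ ⟨$⟩ʳ idx p j)) + toℕ k * p * (j / p)

    formulaRHS-+* : ∀ x t → formulaRHS (x + t * p) ≡ formulaRHS x + t * (toℕ k * p)
    formulaRHS-+* x t = begin
      formulaRHS (x + t * p)
        ≡⟨ cong₂ (λ i q → B i + toℕ k * p * q) (idx-cong ([m+kn]%n≡m%n x t p)) x+tp/p≡x/p+t ⟩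
      B (idx p x) + toℕ k * p * (x / p + t)     ≡⟨ distribute (B (idx p x)) (toℕ k) p (x / p) t ⟩
      formulaRHS x + t * (toℕ k * p)            ∎
      where
      open ≡-Reasoning

      B : Fin p → ℕ
      B i = R i * p + suc (toℕ (φ ⟨$⟩ʳ i))

      x+tp/p≡x/p+t : (x + t * p) / p ≡ x / p + t
      x+tp/p≡x/p+t = trans (+-distrib-/-∣ʳ x (n∣m*n t)) (cong (x / p +_) (m*n/n≡m t p))

      distribute : ∀ b k p q t → b + k * p * (q + t) ≡ b + k * p * q + t * (k * p)
      distribute = solve-∀

    -- The formula constrains only the indices j < n; it extends to every j because
    -- its right-hand side is n-periodic modulo n.
    formula⇒val≈formulaRHS : ∀ π → Formula p φ R k π → ∀ j → val π j ≈ formulaRHS j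
    formula⇒val≈formulaRHS π formula j = begin
      val π j                               ≡⟨ val-cong π (%-≈ j) ⟨
      val π (j % n)                         ≡⟨ cong (val π) (toℕ-idx n j) ⟨
      val π (toℕ (idx n j))                 ≈⟨ formula (idx n j) ⟩
      formulaRHS (toℕ (idx n j))            ≡⟨ cong formulaRHS (toℕ-idx n j) ⟩
      formulaRHS (j % n)                    ≈⟨ +-multiple-≈ (formulaRHS (j % n)) (j / n * toℕ k) ⟨
      formulaRHS (j % n) + j / n * toℕ k * n
                                            ≡⟨ cong (formulaRHS (j % n) +_) (regroup (j / n) (toℕ k)) ⟩
      formulaRHS (j % n) + j / n * m * (toℕ k * p)
                                            ≡⟨ formulaRHS-+* (j % n) (j / n * m) ⟨
      formulaRHS (j % n + j / n * m * p)    ≡⟨ cong formulaRHS j≡j%n+j/n*m*p ⟨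
      formulaRHS j                          ∎
      where
      open ≈-Reasoning

      regroup : ∀ q k → q * k * n ≡ q * m * (k * p)
      regroup q k = trans (cong (q * k *_) n≡m*p) (rearrange q k m p)
        where
        rearrange : ∀ q k a b → q * k * (a * b) ≡ q * a * (k * b)
        rearrange = solve-∀

      j≡j%n+j/n*m*p : j ≡ j % n + j / n * m * p
      j≡j%n+j/n*m*p = trans (m≡m%n+[m/n]*n j n)
        (cong (λ z → j % n + z) (trans (cong (j / n *_) n≡m*p) (sym (*-assoc (j / n) m p))))

    formula⇒shiftsBy : ∀ π → Formula p φ R k π → ShiftsBy π p (toℕ k * p)
    formula⇒shiftsBy π formula = shiftsBy λ j → begin
      val π (j + p)                   ≈⟨ formula⇒val≈formulaRHS π formula (j + p) ⟩
      formulaRHS (j + p)              ≡⟨ cong (λ q → formulaRHS (j + q)) (*-identityˡ p) ⟨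
      formulaRHS (j + 1 * p)          ≡⟨ formulaRHS-+* j 1 ⟩
      formulaRHS j + 1 * (toℕ k * p)  ≡⟨ cong (formulaRHS j +_) (*-identityˡ (toℕ k * p)) ⟩
      formulaRHS j + toℕ k * p        ≈⟨ +-cong (formula⇒val≈formulaRHS π formula j) refl ⟨
      val π j + toℕ k * p             ∎
      where open ≈-Reasoning

    formula-unique : ∀ π σ → Formula p φ R k π → Formula p φ R k σ → ∀ i → π ⟨$⟩ʳ i ≡ σ ⟨$⟩ʳ i
    formula-unique π σ πformula σformula i =
      subst (λ j → π ⟨$⟩ʳ j ≡ σ ⟨$⟩ʳ j) (idx-toℕ i)
        (val-≈⇒≡ π σ (trans (πformula i) (sym (σformula i))))

  representation⇒diffPeriodic : ∀ π → Representation π → DiffPeriodic π p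
  representation⇒diffPeriodic π (φ , R , k , _ , _ , formula) =
    shiftsBy⇒diffPeriodic (formula⇒shiftsBy φ R k π formula)

theorem3p16 : (n p : ℕ) .{{_ : NonZero n}} .{{_ : NonZero p}} → p ∣ n →
    ((π : Permutation′ n) →
      DiffPeriodic π p
        ⇔ Σ (Permutation′ p) (λ φ → Σ (Fin p → ℕ) (λ R → Σ (Fin (n / p)) (λ k →
            ((i : Fin p) → R i < n / p) × (gcd (toℕ k) (n / p) ≡ 1)
              × Formula p φ R k π))))
    × ((φ : Permutation′ p) (R : Fin p → ℕ) (k : Fin (n / p)) (π σ : Permutation′ n) →
        ((i : Fin p) → R i < n / p) → gcd (toℕ k) (n / p) ≡ 1 →
        Formula p φ R k π → Formula p φ R k σ → (i : Fin n) → π ⟨$⟩ʳ i ≡ σ ⟨$⟩ʳ i)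
theorem3p16 n p p∣n =
  (λ π → mk⇔ (diffPeriodic⇒representation π) (representation⇒diffPeriodic π)) ,
  λ φ R k π σ _ _ → formula-unique φ R k π σ
  where open Blocks n p p∣n
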